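{- Let $k\ge2$ and let $G$ be a graph with $\mathrm{stw}(G)\le k$ that is biconnected relative to the equivalence relation $\sim^+_{2k}$. Then $G$ has maximum degree at most $2k^2(k-1)+k-1$.
   Context: For vertices $v_1,v_2$, write $v_1\sim_{2k}v_2$ if there are $2k$ internally vertex-disjoint paths from $v_1$ to $v_2$; $\sim^+_{2k}$ is the transitive closure of this relation (an equivalence relation). $G$ is biconnected relative to an equivalence relation $R$ if the quotient graph (vertices: equivalence classes; two classes adjacent iff some vertices of them are adjacent) is biconnected. A strong tree decomposition of $G$ is $(\{X_i\}_{i\in I},T)$ with $\{X_i\}$ a partition of $V(G)$ and $T$ a tree such that each edge has both ends in one bag or in bags of adjacent tree nodes; width is the maximum bag size; $\mathrm{stw}(G)$ is the minimum width. -}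

module Defs where

open import Data.Nat using (ℕ; zero; suc; _+_; _*_; _≤_)
open import Data.Fin using (Fin; _≟_)
open import Data.Bool using (Bool; true; false; T; if_then_else_)
open import Data.List using (List; []; _∷_; [_]; _++_; length; map; allFin)
open import Data.Nat.ListAction using (sum)
open import Data.List.Membership.Propositional using (_∈_; _∉_)
open import Data.List.Relation.Unary.Unique.Propositional using (Unique)
open import Data.Product using (Σ; ∃; _×_; _,_)
open import Data.Sum using (_⊎_)
open import Data.Unit using (⊤)
open import Relation.Nullary using (¬_; does)
open import Relation.Binary.PropositionalEquality using (_≡_; _≢_)
open import Relation.Binary.Construct.Closure.ReflexiveTransitive using (Star)

record Graph (n : ℕ) : Set where
  field
    adj    : Fin n → Fin n → Bool
    sym    : ∀ u v → adj u v ≡ adj v u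
    irrefl : ∀ v → adj v v ≡ false

module _ {n : ℕ} (G : Graph n) where
  open Graph G

  Adj : Fin n → Fin n → Set
  Adj u v = T (adj u v)

  degree : Fin n → ℕ
  degree v = sum (map (λ w → if adj v w then 1 else 0) (allFin n))

  data IsWalk : List (Fin n) → Set where
    single : ∀ v → IsWalk [ v ]
    cons   : ∀ u v vs → Adj u v → IsWalk (v ∷ vs) → IsWalk (u ∷ v ∷ vs)

  -- ys is the list of interior vertices of a path from u to w,
  -- i.e. u ∷ ys ++ [ w ] is a walk with pairwise distinct vertices
  IsPath : Fin n → Fin n → List (Fin n) → Set
  IsPath u w ys = IsWalk (u ∷ ys ++ [ w ]) × Unique (u ∷ ys ++ [ w ])

  Connected : Set
  Connected = ∀ u w → Star Adj u w

  -- a cycle: a path u … w with at least one interior vertex, closed by the edge w u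
  Acyclic : Set
  Acyclic = ∀ u w ys → IsPath u w ys → 1 ≤ length ys → ¬ Adj w u

  IsTree : Set
  IsTree = Connected × Acyclic

  Sim : ℕ → Fin n → Fin n → Set
  Sim k v₁ v₂ =
    Σ (Fin (2 * k) → List (Fin n)) λ P →
      (∀ i → IsPath v₁ v₂ (P i)) ×
      (∀ i j → i ≢ j → (P i ≢ P j) × (∀ x → x ∈ P i → x ∉ P j))

  SimPlus : ℕ → Fin n → Fin n → Set
  SimPlus k = Star (Sim k)

  -- Biconnectivity of the quotient graph G/R, with classes represented by
  -- vertices of G.  Two classes [x],[y] are adjacent iff some a ∈ [x], b ∈ [y]
  -- are adjacent in G (or we stay in the same class).
  module _ (R : Fin n → Fin n → Set) where
    QStep : (Fin n → Set) → Fin n → Fin n → Set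
    QStep P x y = P x × P y × (R x y ⊎ ∃ λ a → ∃ λ b → R x a × R y b × Adj a b)

    BiconnectedRel : Set
    BiconnectedRel =
      (∀ u w → Star (QStep (λ _ → ⊤)) u w) ×
      (∀ z u w → ¬ R z u → ¬ R z w → Star (QStep (λ x → ¬ R z x)) u w)

-- strong tree decomposition of G: tree Tr on Fin m and bag map f : V(G) → V(Tr);
-- bags X_i = f⁻¹(i) are required nonempty, so {X_i} is a partition of V(G);
-- every edge of G lies inside a bag or between bags of adjacent tree nodes.
bagSize : ∀ {n m} → (Fin n → Fin m) → Fin m → ℕ
bagSize {n} f i = sum (map (λ v → if does (f v ≟ i) then 1 else 0) (allFin n))

IsStrongTD : ∀ {n m} → Graph n → Graph m → (Fin n → Fin m) → Set
IsStrongTD G Tr f =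
  IsTree Tr × (∀ i → ∃ λ v → f v ≡ i) ×
  (∀ u v → Adj G u v → f u ≡ f v ⊎ Adj Tr (f u) (f v))

stw≤ : ∀ {n} → Graph n → ℕ → Set
stw≤ {n} G k =
  Σ ℕ λ m → Σ (Graph m) λ Tr → Σ (Fin n → Fin m) λ f →
    IsStrongTD G Tr f × (∀ i → bagSize f i ≤ k)

MaxDegree≤ : ∀ {n} → Graph n → ℕ → Set
MaxDegree≤ {n} G d = ∀ v → degree G v ≤ d

-- Fix v and let t = f v be the tree node whose bag X contains it.  Deleting t splits the
-- tree into branches, one for each tree neighbour r of t.  Two counting arguments control
-- ∼_{2k} near X.  If x lies in the branch of r and a ∈ X, each of 2k internally disjoint
-- x–a paths contributes a distinct vertex of X ∪ X_r: its first interior vertex in X, or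
-- else its last interior vertex, which lies in X_r, or x itself if the path is the edge xa.
-- With a these are 2k + 1 vertices in a set of size at most 2k, so x ≁_{2k} a.  If neither
-- x nor a lies in X, one of the 2k paths avoids X, since |X| ≤ k.  Hence the ∼⁺-class of a
-- vertex in a branch is reachable from it inside that branch without meeting X.
--
-- A neighbour of v lies in X (at most k − 1 of those) or in a bag X_r with r adjacent to t
-- (at most k in each such "active" branch).  With at least two active branches,
-- biconnectivity of G/∼⁺ minus the class of v leads, for every active branch, from v
-- through the branch to some b ∈ X ∖ {v} with v ≁⁺ b.  If 2k active branches led to the
-- same b, their paths would give v ∼_{2k} b; hence there are at most (2k − 1)(k − 1) active
-- branches and deg v ≤ (k − 1) + k (2k − 1)(k − 1) ≤ 2k²(k − 1) + k − 1.

module Submission where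

open import Defs
open import Data.Nat using (ℕ; zero; suc; _+_; _*_; _∸_; _^_; _≤_; _<_; z≤n; s≤s; _≤?_)
open import Data.Nat.Properties
  using ( module ≤-Reasoning; ≤-refl; ≤-trans; ≤-reflexive; ≤-pred; <⇒≱; ≰⇒>; n≤0⇒n≡0
        ; +-identityʳ; +-suc; *-identityʳ; *-zeroʳ; m≤m+n; m<m+n
        ; +-mono-≤; +-monoʳ-≤; +-mono-<-≤; +-mono-≤-<; *-monoʳ-≤; ∸-monoˡ-≤; +-*-semiring )
open import Data.Nat.ListAction using (sum)
open import Data.Nat.Tactic.RingSolver using (solve-∀)
open import Data.Fin using (Fin; zero; suc; _≟_; fromℕ<)
open import Data.Fin.Properties using (0≢1+n; suc-injective; any?)
open import Data.Bool using (Bool; true; false; T; if_then_else_; _∧_; _∨_; not)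
open import Data.Bool.Properties using (T-∧; T-∨)
open import Data.List using (List; []; _∷_; [_]; _++_; map; allFin; tabulate; reverse; reverseAcc)
open import Data.List.Properties using (map-tabulate; reverse-++; reverse-injective)
open import Data.List.Membership.Propositional using (_∈_; _∉_; find)
open import Data.List.Membership.Propositional.Properties using (∈-++⁺ˡ; ∈-++⁺ʳ)
open import Data.List.Relation.Unary.Any as Any using (Any; here; there)
open import Data.List.Relation.Unary.Any.Properties using (reverse⁻)
open import Data.List.Relation.Unary.All as All using (All; []; _∷_)
open import Data.List.Relation.Unary.All.Properties using (¬Any⇒All¬)
import Data.List.Relation.Unary.All.Properties as All
open import Data.List.Relation.Unary.Unique.Propositional using (Unique; []; _∷_)
import Data.List.Relation.Unary.Unique.Propositional.Properties as Unique
open import Data.List.Relation.Binary.Subset.Propositional using (_⊆_)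
open import Data.List.Relation.Binary.Permutation.Propositional using (↭⇒↭ₛ; ↭-sym)
open import Data.List.Relation.Binary.Permutation.Propositional.Properties using (↭-reverse)
import Data.List.Relation.Binary.Permutation.Setoid.Properties as Permutation
open import Data.Product using (Σ; ∃; ∃₂; _×_; _,_; proj₁; proj₂)
open import Data.Sum using (_⊎_; inj₁; inj₂)
open import Data.Empty using (⊥; ⊥-elim)
open import Data.Unit using (tt)
open import Function using (_∘_)
open import Function.Bundles using (module Equivalence)
open Equivalence using (to; from)
open import Function.Definitions using (Injective)
open import Relation.Nullary using (¬_; Dec; yes; no; does)
open import Relation.Nullary.Decidable using (¬?; _×-dec_; T?; decidable-stable)
open import Relation.Binary using (DecidableEquality)
open import Relation.Binary.PropositionalEquality using (_≡_; _≢_; refl; sym; trans; cong; subst; setoid)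
open import Relation.Binary.Construct.Closure.ReflexiveTransitive using (Star; ε; _◅_; _◅◅_)
  renaming (reverse to Star-reverse)
open import Algebra.Properties.Semiring.Sum +-*-semiring
  using (sum-syntax; sum-cong-≗; ∑-comm; ∑-distrib-+; sum-replicate-zero; *-distribˡ-sum)

-- Counting subsets of Fin n

module _ {n : ℕ} {x y : Fin n} where

  T-≟⁺ : x ≡ y → T (does (x ≟ y))
  T-≟⁺ x≡y with x ≟ y
  ... | yes _ = tt
  ... | no x≢y = x≢y x≡y

  T-≟⁻ : T (does (x ≟ y)) → x ≡ y
  T-≟⁻ t with x ≟ y
  ... | yes x≡y = x≡y

  T-not-≟⁺ : x ≢ y → T (not (does (x ≟ y)))
  T-not-≟⁺ x≢y with x ≟ y
  ... | yes x≡y = x≢y x≡y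
  ... | no _ = tt

  T-not-≟⁻ : T (not (does (x ≟ y))) → x ≢ y
  T-not-≟⁻ t x≡y with x ≟ y
  ... | no x≢y = x≢y x≡y

indicator : Bool → ℕ
indicator b = if b then 1 else 0

count : ∀ {n} → (Fin n → Bool) → ℕ
count {n} p = ∑[ x < n ] indicator (p x)

sum-tabulate : ∀ {n} (h : Fin n → ℕ) → sum (tabulate h) ≡ ∑[ x < n ] h x
sum-tabulate {zero} h = refl
sum-tabulate {suc n} h = cong (h zero +_) (sum-tabulate (h ∘ suc))

sum-allFin≡count : ∀ {n} (p : Fin n → Bool) → sum (map (indicator ∘ p) (allFin n)) ≡ count p
sum-allFin≡count p =
  trans (cong sum (map-tabulate (λ x → x) (indicator ∘ p))) (sum-tabulate (indicator ∘ p))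

∑-mono-≤ : ∀ {n} {f g : Fin n → ℕ} → (∀ x → f x ≤ g x) →
  ∑[ x < n ] f x ≤ ∑[ x < n ] g x
∑-mono-≤ {zero} _ = z≤n
∑-mono-≤ {suc n} f≤g = +-mono-≤ (f≤g zero) (∑-mono-≤ (f≤g ∘ suc))

∑-mono-< : ∀ {n} {f g : Fin n → ℕ} → (∀ x → f x ≤ g x) → ∀ u → f u < g u →
  ∑[ x < n ] f x < ∑[ x < n ] g x
∑-mono-< f≤g zero fu<gu = +-mono-<-≤ fu<gu (∑-mono-≤ (f≤g ∘ suc))
∑-mono-< f≤g (suc u) fu<gu = +-mono-≤-< (f≤g zero) (∑-mono-< (f≤g ∘ suc) u fu<gu)

indicator-mono : ∀ {a b} → (T a → T b) → indicator a ≤ indicator b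
indicator-mono {false} _ = z≤n
indicator-mono {true} {true} _ = ≤-refl
indicator-mono {true} {false} a⇒b = ⊥-elim (a⇒b tt)

indicator-mono-< : ∀ {a b} → ¬ T a → T b → indicator a < indicator b
indicator-mono-< {false} {true} _ _ = s≤s z≤n
indicator-mono-< {true} ¬a _ = ⊥-elim (¬a tt)

indicator-∨ : ∀ a b → indicator (a ∨ b) ≤ indicator a + indicator b
indicator-∨ false b = ≤-refl
indicator-∨ true false = ≤-refl
indicator-∨ true true = s≤s z≤n

count-mono : ∀ {n} {p q : Fin n → Bool} → (∀ x → T (p x) → T (q x)) → count p ≤ count q
count-mono p⇒q = ∑-mono-≤ (indicator-mono ∘ p⇒q)

count-mono-< : ∀ {n} {p q : Fin n → Bool} → (∀ x → T (p x) → T (q x)) →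
  ∀ u → ¬ T (p u) → T (q u) → count p < count q
count-mono-< p⇒q u ¬pu qu = ∑-mono-< (indicator-mono ∘ p⇒q) u (indicator-mono-< ¬pu qu)

count-∨ : ∀ {n} (p q : Fin n → Bool) → count (λ x → p x ∨ q x) ≤ count p + count q
count-∨ p q = ≤-trans (∑-mono-≤ (λ x → indicator-∨ (p x) (q x)))
  (≤-reflexive (∑-distrib-+ (indicator ∘ p) (indicator ∘ q)))

indicator-split-∧ : ∀ a b → indicator a ≤ indicator (a ∧ b) + indicator (a ∧ not b)
indicator-split-∧ false b = z≤n
indicator-split-∧ true false = ≤-refl
indicator-split-∧ true true = ≤-refl

count-split : ∀ {n} (p q : Fin n → Bool) →
  count p ≤ count (λ x → p x ∧ q x) + count (λ x → p x ∧ not (q x))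
count-split p q = ≤-trans (∑-mono-≤ (λ x → indicator-split-∧ (p x) (q x)))
  (≤-reflexive (∑-distrib-+ (λ x → indicator (p x ∧ q x)) (λ x → indicator (p x ∧ not (q x)))))

count-none : ∀ {n} (p : Fin n → Bool) → (∀ x → ¬ T (p x)) → count p ≡ 0
count-none {n} p ¬p = n≤0⇒n≡0 (≤-trans
  (∑-mono-≤ {g = λ _ → 0} (λ x → indicator-mono (⊥-elim ∘ ¬p x)))
  (≤-reflexive (sum-replicate-zero n)))

count-singleton : ∀ {n} (c : Fin n) → count (λ x → does (c ≟ x)) ≡ 1
count-singleton {suc n} zero = cong suc (count-none {n} (λ x → does (zero ≟ suc x)) (λ _ ()))
count-singleton {suc n} (suc c) = count-singleton c

injective⇒≤count : ∀ {c n} {p : Fin n → Bool} (z : Fin c → Fin n) →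
  Injective _≡_ _≡_ z → (∀ i → T (p (z i))) → c ≤ count p
injective⇒≤count {zero} _ _ _ = z≤n
injective⇒≤count {suc c} {p = p} z z-inj pz =
  ≤-trans (s≤s (injective⇒≤count (z ∘ suc) (suc-injective ∘ z-inj) p′z))
          (count-mono-< p′⇒p (z zero) ¬p′z₀ (pz zero))
  where
  p′ : _ → Bool
  p′ y = p y ∧ not (does (z zero ≟ y))
  p′⇒p : ∀ y → T (p′ y) → T (p y)
  p′⇒p y = proj₁ ∘ to (T-∧ {p y})
  p′z : ∀ i → T (p′ (z (suc i)))
  p′z i = from T-∧ (pz (suc i) , T-not-≟⁺ (λ e → 0≢1+n (z-inj e)))
  ¬p′z₀ : ¬ T (p′ (z zero))
  ¬p′z₀ t = T-not-≟⁻ {x = z zero} (proj₂ (to (T-∧ {p (z zero)}) t)) refl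

choose : ∀ {c n} (p : Fin n → Bool) → c ≤ count p →
  Σ (Fin c → Fin n) λ z → Injective _≡_ _≡_ z × (∀ i → T (p (z i)))
choose {zero} _ _ = (λ ()) , (λ { {()} }) , (λ ())
choose {suc c} {suc n} p c<count with p zero in p₀
... | false with z , z-inj , pz ← choose (p ∘ suc) c<count = suc ∘ z , z-inj ∘ suc-injective , pz
... | true with z , z-inj , pz ← choose (p ∘ suc) (≤-pred c<count) = z′ , z′-inj , pz′
  where
  z′ : Fin (suc c) → Fin (suc n)
  z′ zero = zero
  z′ (suc i) = suc (z i)
  z′-inj : Injective _≡_ _≡_ z′
  z′-inj {zero} {zero} _ = refl
  z′-inj {zero} {suc j} e = ⊥-elim (0≢1+n e)
  z′-inj {suc i} {zero} e = ⊥-elim (0≢1+n (sym e))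
  z′-inj {suc i} {suc j} e = cong suc (z-inj (suc-injective e))
  pz′ : ∀ i → T (p (z′ i))
  pz′ zero = subst T (sym p₀) tt
  pz′ (suc i) = pz i

indicator-split : ∀ {m} a (y : Fin m) → indicator a ≡ ∑[ b < m ] indicator (a ∧ does (y ≟ b))
indicator-split {m} false y = sym (sum-replicate-zero m)
indicator-split true y = sym (count-singleton y)

count-fibres : ∀ {n m} {p : Fin n → Bool} {q : Fin m → Bool} (g : Fin n → Fin m) {c} →
  (∀ x → T (p x) → T (q (g x))) →
  (∀ b → T (q b) → count (λ x → p x ∧ does (g x ≟ b)) ≤ c) → count p ≤ c * count q
count-fibres {n} {m} {p} {q} g {c} p⇒qg fibre≤ = begin
  count p                                          ≡⟨ sum-cong-≗ (λ x → indicator-split (p x) (g x)) ⟩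
  ∑[ x < n ] ∑[ b < m ] fibres x b                 ≡⟨ ∑-comm fibres ⟩
  ∑[ b < m ] count (λ x → p x ∧ does (g x ≟ b))    ≤⟨ ∑-mono-≤ fibre≤c·q ⟩
  ∑[ b < m ] (c * indicator (q b))                 ≡⟨ *-distribˡ-sum c (indicator ∘ q) ⟨
  c * count q                                      ∎
  where
  open ≤-Reasoning
  fibres : Fin n → Fin m → ℕ
  fibres x b = indicator (p x ∧ does (g x ≟ b))
  empty : ∀ b → ¬ T (q b) → ∀ x → ¬ T (p x ∧ does (g x ≟ b))
  empty b ¬qb x t with px , gx≡b ← to (T-∧ {p x}) t =
    ¬qb (subst (T ∘ q) (T-≟⁻ gx≡b) (p⇒qg x px))
  fibre≤c·q : ∀ b → count (λ x → p x ∧ does (g x ≟ b)) ≤ c * indicator (q b)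
  fibre≤c·q b with q b in q-b
  ... | true = subst (_ ≤_) (sym (*-identityʳ c)) (fibre≤ b (subst T (sym q-b) tt))
  ... | false = ≤-reflexive (trans (count-none _ (empty b (subst T q-b))) (sym (*-zeroʳ c)))

-- Paths and chains

Unique-reverse : ∀ {A : Set} {xs : List A} → Unique xs → Unique (reverse xs)
Unique-reverse {A} {xs} = Permutation.Unique-resp-↭ (setoid A) (↭⇒↭ₛ (↭-sym (↭-reverse xs)))

module _ {n : ℕ} (G : Graph n) where
  open Graph G using (irrefl) renaming (sym to adj-sym)

  Adj-sym : ∀ {u v} → Adj G u v → Adj G v u
  Adj-sym {u} {v} = subst T (adj-sym u v)

  Adj-irrefl : ∀ {u v} → Adj G u v → u ≢ v
  Adj-irrefl {u} uv refl = subst T (irrefl u) uv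

  IsWalk-reverseAcc : ∀ x xs acc → IsWalk G (x ∷ xs) → IsWalk G (x ∷ acc) →
    IsWalk G (reverseAcc (x ∷ acc) xs)
  IsWalk-reverseAcc x [] acc _ w = w
  IsWalk-reverseAcc x (y ∷ ys) acc (cons _ _ _ xy w) w′ =
    IsWalk-reverseAcc y ys (x ∷ acc) w (cons y x acc (Adj-sym xy) w′)

  IsPath-reverse : ∀ {u w ys} → IsPath G u w ys → IsPath G w u (reverse ys)
  IsPath-reverse {u} {w} {ys} (walk , unique) =
    subst (IsWalk G) reverse-path (IsWalk-reverseAcc u (ys ++ [ w ]) [] walk (single u)) ,
    subst Unique reverse-path (Unique-reverse unique)
    where
    reverse-path : reverse (u ∷ ys ++ [ w ]) ≡ w ∷ reverse ys ++ [ u ]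
    reverse-path = trans (reverse-++ (u ∷ ys) [ w ]) (cong (w ∷_) (reverse-++ [ u ] ys))

  IsPath-start∉ : ∀ {u w ys} → IsPath G u w ys → u ∉ ys
  IsPath-start∉ (_ , u∉ ∷ _) u∈ = All.lookup u∉ (∈-++⁺ˡ u∈) refl

  IsPath-start≢end : ∀ {u w ys} → IsPath G u w ys → u ≢ w
  IsPath-start≢end {ys = ys} (_ , u∉ ∷ _) = All.lookup u∉ (∈-++⁺ʳ ys (here refl))

  IsPath-end∉ : ∀ {u w ys} → IsPath G u w ys → w ∉ ys
  IsPath-end∉ {ys = ys} (_ , _ ∷ unique) = go ys unique
    where
    go : ∀ {w} ys → Unique (ys ++ [ w ]) → w ∉ ys
    go (y ∷ ys) (w∉ ∷ _) (here refl) = All.lookup w∉ (∈-++⁺ʳ ys (here refl)) refl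
    go (y ∷ ys) (_ ∷ unique) (there w∈) = go ys unique w∈

  Sim-sym : ∀ {k x y} → Sim G k x y → Sim G k y x
  Sim-sym (P , paths , disjoint) =
    (λ i → reverse (P i)) , (λ i → IsPath-reverse (paths i)) ,
    λ i j i≢j → (λ e → proj₁ (disjoint i j i≢j) (reverse-injective e)) ,
                λ z z∈i z∈j → proj₂ (disjoint i j i≢j) z (reverse⁻ z∈i) (reverse⁻ z∈j)

  SimPlus-sym : ∀ {k x y} → SimPlus G k x y → SimPlus G k y x
  SimPlus-sym {k} = Star-reverse (Sim-sym {k})

data Chain {A : Set} (R : A → A → Set) : A → A → List A → Set where
  end : ∀ x → Chain R x x [ x ]
  _∷_ : ∀ {x y a vs} → R x y → Chain R y a vs → Chain R x a (x ∷ vs)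

module _ {A : Set} {R : A → A → Set} where

  Star⇒Chain : ∀ {x a} → Star R x a → ∃ (Chain R x a)
  Star⇒Chain {x} ε = [ x ] , end x
  Star⇒Chain (r ◅ rs) with vs , chain ← Star⇒Chain rs = _ , r ∷ chain

  Chain-head : ∀ {x a vs} → Chain R x a vs → x ∈ vs
  Chain-head (end x) = here refl
  Chain-head (_ ∷ _) = here refl

  Chain-last : ∀ {x a vs} → Chain R x a vs → ∃ λ ys → vs ≡ ys ++ [ a ]
  Chain-last (end x) = [] , refl
  Chain-last {x} (_ ∷ chain) with ys , refl ← Chain-last chain = x ∷ ys , refl

  Chain-All : ∀ (P : A → Set) → (∀ {u v} → P u → R u v → P v) →
    ∀ {x a vs} → P x → Chain R x a vs → All P vs
  Chain-All P step px (end x) = px ∷ []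
  Chain-All P step px (r ∷ chain) = px ∷ Chain-All P step (step px r) chain

  module _ (_≟ᴬ_ : DecidableEquality A) where

    ShortChain : A → A → List A → Set
    ShortChain x a vs = ∃ λ qs → Chain R x a qs × Unique qs × qs ⊆ vs

    Chain-suffix : ∀ {y a vs} z → Chain R y a vs → z ∈ vs → Unique vs → ShortChain z a vs
    Chain-suffix z chain@(end _) (here refl) unique = _ , chain , unique , λ q∈ → q∈
    Chain-suffix z chain@(_ ∷ _) (here refl) unique = _ , chain , unique , λ q∈ → q∈
    Chain-suffix z (_ ∷ chain) (there z∈) (_ ∷ unique)
      with qs , chain′ , unique′ , qs⊆ ← Chain-suffix z chain z∈ unique =
      qs , chain′ , unique′ , there ∘ qs⊆

    Chain-shorten : ∀ {x a vs} → Chain R x a vs → ShortChain x a vs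
    Chain-shorten (end x) = _ , end x , [] ∷ [] , λ q∈ → q∈
    Chain-shorten {x} (r ∷ chain)
      with ps , chain′ , unique , ps⊆ ← Chain-shorten chain | Any.any? (x ≟ᴬ_) ps
    ... | yes x∈ with qs , chain″ , unique′ , qs⊆ ← Chain-suffix x chain′ x∈ unique =
      qs , chain″ , unique′ , there ∘ ps⊆ ∘ qs⊆
    ... | no x∉ = _ , r ∷ chain′ , All.tabulate (λ { z∈ refl → x∉ z∈ }) ∷ unique ,
      λ { (here refl) → here refl ; (there q∈) → there (ps⊆ q∈) }

Chain⇒IsWalk : ∀ {n} (G : Graph n) {R : Fin n → Fin n → Set} → (∀ {u v} → R u v → Adj G u v) →
  ∀ {x a vs} → Chain R x a vs → IsWalk G vs
Chain⇒IsWalk G R⇒Adj (end x) = single x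
Chain⇒IsWalk G R⇒Adj (r ∷ end x) = cons _ _ _ (R⇒Adj r) (single x)
Chain⇒IsWalk G R⇒Adj (r ∷ chain@(_ ∷ _)) = cons _ _ _ (R⇒Adj r) (Chain⇒IsWalk G R⇒Adj chain)

Chain⇒IsWalk-extend : ∀ {n} (G : Graph n) {R : Fin n → Fin n → Set} → (∀ {u v} → R u v → Adj G u v) →
  ∀ {u x a b vs} → Adj G u x → Chain R x a vs → Adj G a b → IsWalk G (u ∷ vs ++ [ b ])
Chain⇒IsWalk-extend G R⇒Adj ux (end x) ab = cons _ _ _ ux (cons _ _ _ ab (single _))
Chain⇒IsWalk-extend G R⇒Adj ux (r ∷ chain) ab =
  cons _ _ _ ux (Chain⇒IsWalk-extend G R⇒Adj (R⇒Adj r) chain ab)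

-- Branches of a tree at a node

module Branches {m : ℕ} (Tr : Graph m) (tree : IsTree Tr) (t : Fin m) where

  Adj∖t : Fin m → Fin m → Set
  Adj∖t s s′ = Adj Tr s s′ × s ≢ t × s′ ≢ t

  Reach∖t : Fin m → Fin m → Set
  Reach∖t = Star Adj∖t

  InBranch : Fin m → Fin m → Set
  InBranch r s = Adj Tr t r × Reach∖t r s

  Adj∖t-sym : ∀ {s s′} → Adj∖t s s′ → Adj∖t s′ s
  Adj∖t-sym (ss′ , s≢t , s′≢t) = Adj-sym Tr ss′ , s′≢t , s≢t

  InBranch-≢ : ∀ {r s} → InBranch r s → s ≢ t
  InBranch-≢ (tr , rs) = go (λ r≡t → Adj-irrefl Tr tr (sym r≡t)) rs
    where
    go : ∀ {r s} → r ≢ t → Reach∖t r s → s ≢ t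
    go r≢t ε = r≢t
    go _ ((_ , _ , s≢t) ◅ rs) = go s≢t rs

  InBranch-step : ∀ {r s s′} → InBranch r s → Reach∖t s s′ → InBranch r s′
  InBranch-step (tr , rs) ss′ = tr , rs ◅◅ ss′

  -- Two neighbours of t joined by a path avoiding t would close a cycle through t.
  root-unique : ∀ {r₁ r₂} → Adj Tr t r₁ → Adj Tr t r₂ → Reach∖t r₁ r₂ → r₁ ≡ r₂
  root-unique {r₁} {r₂} tr₁ tr₂ r₁r₂ with Chain-shorten _≟_ (proj₂ (Star⇒Chain r₁r₂))
  ... | _ , end _ , _ = refl
  ... | _ , chain@(_ ∷ chain′) , unique , _ with ys , refl ← Chain-last chain′ =
    ⊥-elim (proj₂ tree t r₂ (r₁ ∷ ys) (walk , t∉ ∷ unique) (s≤s z≤n) (Adj-sym Tr tr₂))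
    where
    walk : IsWalk Tr (t ∷ r₁ ∷ ys ++ [ r₂ ])
    walk = cons t r₁ _ tr₁ (Chain⇒IsWalk Tr proj₁ chain)
    t∉ : All (t ≢_) (r₁ ∷ ys ++ [ r₂ ])
    t∉ = All.map (λ s≢t t≡s → s≢t (sym t≡s))
      (Chain-All (_≢ t) (λ _ → proj₂ ∘ proj₂) (λ r₁≡t → Adj-irrefl Tr tr₁ (sym r₁≡t)) chain)

  InBranch-unique : ∀ {r₁ r₂ s} → InBranch r₁ s → InBranch r₂ s → r₁ ≡ r₂
  InBranch-unique (tr₁ , r₁s) (tr₂ , r₂s) =
    root-unique tr₁ tr₂ (r₁s ◅◅ Star-reverse Adj∖t-sym r₂s)

  InBranch-adj-t : ∀ {r s} → InBranch r s → Adj Tr s t → s ≡ r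
  InBranch-adj-t (tr , rs) st = sym (root-unique tr (Adj-sym Tr st) rs)

-- Vertices near a bag of a strong tree decomposition

bag : ∀ {n m} → (Fin n → Fin m) → Fin m → Fin n → Bool
bag f i x = does (f x ≟ i)

module _ {n : ℕ} (G : Graph n) where

  -- z stands for the path x ∷ P ++ [ a ]: an interior vertex, or x itself when there is none
  Represents : Fin n → List (Fin n) → Fin n → Set
  Represents x P z = z ∈ P ⊎ (P ≡ [] × z ≡ x)

  representatives-injective : ∀ {k x a} (sim : Sim G k x a) {z : Fin (2 * k) → Fin n} →
    (∀ i → Represents x (proj₁ sim i) (z i)) → Injective _≡_ _≡_ z
  representatives-injective {x = x} (P , paths , disjoint) {z} rep {i} {j} zi≡zj with i ≟ j
  ... | yes i≡j = i≡j
  ... | no i≢j = ⊥-elim (clash (rep i) (rep j))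
    where
    clash : Represents x (P i) (z i) → Represents x (P j) (z j) → ⊥
    clash (inj₁ ∈i) (inj₁ ∈j) = proj₂ (disjoint i j i≢j) (z i) ∈i (subst (_∈ P j) (sym zi≡zj) ∈j)
    clash (inj₁ ∈i) (inj₂ (_ , zj≡x)) =
      IsPath-start∉ G (paths i) (subst (_∈ P i) (trans zi≡zj zj≡x) ∈i)
    clash (inj₂ (_ , zi≡x)) (inj₁ ∈j) =
      IsPath-start∉ G (paths j) (subst (_∈ P j) (trans (sym zi≡zj) zi≡x) ∈j)
    clash (inj₂ (Pi≡[] , _)) (inj₂ (Pj≡[] , _)) = proj₁ (disjoint i j i≢j) (trans Pi≡[] (sym Pj≡[]))

  Represents⇒∈ : ∀ {y ys z} → Represents y ys z → z ∈ y ∷ ys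
  Represents⇒∈ (inj₁ z∈) = there z∈
  Represents⇒∈ (inj₂ (_ , z≡y)) = here z≡y

module Decomposition {n m : ℕ} (G : Graph n) (Tr : Graph m) (f : Fin n → Fin m) (tree : IsTree Tr)
  (edge : ∀ u v → Adj G u v → f u ≡ f v ⊎ Adj Tr (f u) (f v))
  (k : ℕ) (0<k : 0 < k) (bag≤ : ∀ i → count (bag f i) ≤ k) (t : Fin m) where

  open Branches Tr tree t public

  Adj∖X : Fin n → Fin n → Set
  Adj∖X x y = Adj G x y × f x ≢ t × f y ≢ t

  Conn∖X : Fin n → Fin n → Set
  Conn∖X = Star Adj∖X

  InBranch-Conn : ∀ {r x y} → InBranch r (f x) → Conn∖X x y → InBranch r (f y)
  InBranch-Conn ib ε = ib
  InBranch-Conn {x = x} ib (_◅_ {j = y} (xy , fx≢t , fy≢t) rest) with edge x y xy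
  ... | inj₁ fx≡fy = InBranch-Conn (subst (InBranch _) fx≡fy ib) rest
  ... | inj₂ fx—fy = InBranch-Conn (InBranch-step ib ((fx—fy , fx≢t , fy≢t) ◅ ε)) rest

  InBranch-adj-X : ∀ {r x a} → InBranch r (f x) → Adj G x a → f a ≡ t → f x ≡ r
  InBranch-adj-X {x = x} {a} ib xa fa≡t with edge x a xa
  ... | inj₁ fx≡fa = ⊥-elim (InBranch-≢ ib (trans fx≡fa fa≡t))
  ... | inj₂ fx—fa = InBranch-adj-t ib (subst (Adj Tr (f x)) fa≡t fx—fa)

  IsWalk⇒Conn∖X : ∀ {x a} ys → IsWalk G (x ∷ ys ++ [ a ]) →
    f x ≢ t → All (λ z → f z ≢ t) ys → f a ≢ t → Conn∖X x a
  IsWalk⇒Conn∖X [] (cons _ _ _ xa _) fx≢t [] fa≢t = (xa , fx≢t , fa≢t) ◅ ε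
  IsWalk⇒Conn∖X (y ∷ ys) (cons _ _ _ xy walk) fx≢t (fy≢t ∷ off) fa≢t =
    (xy , fx≢t , fy≢t) ◅ IsWalk⇒Conn∖X ys walk fy≢t off fa≢t

  Sim⇒Conn∖X : ∀ {x a} → Sim G k x a → f x ≢ t → f a ≢ t → Conn∖X x a
  Sim⇒Conn∖X sim@(P , paths , _) fx≢t fa≢t with any? (λ i → ¬? (Any.any? (λ z → f z ≟ t) (P i)))
  ... | yes (i , avoids) =
    IsWalk⇒Conn∖X (P i) (proj₁ (paths i)) fx≢t (¬Any⇒All¬ (P i) avoids) fa≢t
  ... | no ¬avoids = ⊥-elim (<⇒≱ k<2k (≤-trans (injective⇒≤count z z-inj z∈X) (bag≤ t)))
    where
    hits : ∀ i → Any (λ z → f z ≡ t) (P i)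
    hits i = decidable-stable (Any.any? (λ z → f z ≟ t) (P i)) (λ avoids → ¬avoids (i , avoids))
    z : Fin (2 * k) → Fin n
    z i = proj₁ (find (hits i))
    z-inj : Injective _≡_ _≡_ z
    z-inj = representatives-injective G {k = k} sim (λ i → inj₁ (proj₁ (proj₂ (find (hits i)))))
    z∈X : ∀ i → T (bag f t (z i))
    z∈X i = T-≟⁺ (proj₂ (proj₂ (find (hits i))))
    k<2k : k < 2 * k
    k<2k = m<m+n k (≤-trans 0<k (m≤m+n k 0))

  inBags : Fin m → Fin n → Bool
  inBags r z = bag f t z ∨ bag f r z

  branch-exit : ∀ {r x a} → InBranch r (f x) → f a ≡ t → ∀ ys → IsWalk G (x ∷ ys ++ [ a ]) →
    ∃ λ z → T (inBags r z) × Represents G x ys z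
  branch-exit {x = x} ib fa≡t [] (cons _ _ _ xa _) =
    x , from T-∨ (inj₂ (T-≟⁺ (InBranch-adj-X ib xa fa≡t))) , inj₂ (refl , refl)
  branch-exit {x = x} ib fa≡t (y ∷ ys) (cons _ _ _ xy walk) with f y ≟ t
  ... | yes fy≡t = y , from T-∨ (inj₁ (T-≟⁺ fy≡t)) , inj₁ (here refl)
  ... | no fy≢t
    with z , z∈ , rep ← branch-exit (InBranch-Conn ib ((xy , InBranch-≢ ib , fy≢t) ◅ ε)) fa≡t ys walk =
    z , z∈ , inj₁ (Represents⇒∈ G rep)

  ¬Sim-branch→X : ∀ {r x a} → InBranch r (f x) → f a ≡ t → ¬ Sim G k x a
  ¬Sim-branch→X {r} {x} {a} ib fa≡t sim@(P , paths , _) = <⇒≱ 2k<inBags inBags≤2k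
    where
    exits : ∀ i → ∃ λ z → T (inBags r z) × Represents G x (P i) z
    exits i = branch-exit ib fa≡t (P i) (proj₁ (paths i))
    z : Fin (2 * k) → Fin n
    z i = proj₁ (exits i)
    z≢a : ∀ i → z i ≢ a
    z≢a i with proj₂ (proj₂ (exits i))
    ... | inj₁ z∈ = λ z≡a → IsPath-end∉ G (paths i) (subst (_∈ P i) z≡a z∈)
    ... | inj₂ (_ , z≡x) = λ z≡a → IsPath-start≢end G (paths i) (trans (sym z≡x) z≡a)
    2k<inBags : 2 * k < count (inBags r)
    2k<inBags = ≤-trans
      (s≤s (injective⇒≤count {p = λ y → inBags r y ∧ not (does (a ≟ y))} z
        (representatives-injective G {k = k} sim (proj₂ ∘ proj₂ ∘ exits))
        (λ i → from T-∧ (proj₁ (proj₂ (exits i)) , T-not-≟⁺ (z≢a i ∘ sym)))))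
      (count-mono-< (λ y → proj₁ ∘ to (T-∧ {inBags r y})) a
        (λ a∈ → T-not-≟⁻ {x = a} (proj₂ (to (T-∧ {inBags r a}) a∈)) refl)
        (from T-∨ (inj₁ (T-≟⁺ fa≡t))))
    inBags≤2k : count (inBags r) ≤ 2 * k
    inBags≤2k = ≤-trans (count-∨ (bag f t) (bag f r))
      (≤-trans (+-mono-≤ (bag≤ t) (bag≤ r)) (≤-reflexive (cong (k +_) (sym (+-identityʳ k)))))

  Sim-from-branch : ∀ {r x a} → InBranch r (f x) → Sim G k x a → Conn∖X x a
  Sim-from-branch {a = a} ib sim with f a ≟ t
  ... | yes fa≡t = ⊥-elim (¬Sim-branch→X ib fa≡t sim)
  ... | no fa≢t = Sim⇒Conn∖X sim (InBranch-≢ ib) fa≢t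

  SimPlus-from-branch : ∀ {r x a} → InBranch r (f x) → SimPlus G k x a → Conn∖X x a
  SimPlus-from-branch ib ε = ε
  SimPlus-from-branch ib (sim ◅ sims) =
    let xy = Sim-from-branch ib sim in xy ◅◅ SimPlus-from-branch (InBranch-Conn ib xy) sims

  Conn∖X-SimPlus : ∀ {r w x y} → InBranch r (f w) → Conn∖X w x → SimPlus G k x y → Conn∖X w y
  Conn∖X-SimPlus ib wx xy = wx ◅◅ SimPlus-from-branch (InBranch-Conn ib wx) xy

  ¬SimPlus-X→branch : ∀ {r x y} → InBranch r (f x) → f y ≡ t → ¬ SimPlus G k y x
  ¬SimPlus-X→branch ib fy≡t yx =
    InBranch-≢ (InBranch-Conn ib (SimPlus-from-branch ib (SimPlus-sym G {k = k} yx))) fy≡t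

-- The degree bound

1≤[2k∸1]*[k∸1] : ∀ {k} → 2 ≤ k → 1 ≤ (2 * k ∸ 1) * (k ∸ 1)
1≤[2k∸1]*[k∸1] {suc zero} (s≤s ())
1≤[2k∸1]*[k∸1] {suc (suc _)} _ = s≤s z≤n

degree-identity : ∀ a →
  a + (1 + a) * ((a + (1 + (a + 0))) * a) + (1 + a) * a ≡ 2 * ((1 + a) * ((1 + a) * 1)) * a + a
degree-identity = solve-∀

degree-arith : ∀ k → (k ∸ 1) + k * ((2 * k ∸ 1) * (k ∸ 1)) ≤ 2 * k ^ 2 * (k ∸ 1) + k ∸ 1
degree-arith zero = z≤n
degree-arith (suc a) = begin
  a + suc a * ((a + suc (a + 0)) * a)              ≤⟨ m≤m+n _ (suc a * a) ⟩
  a + suc a * ((a + suc (a + 0)) * a) + suc a * a  ≡⟨ degree-identity a ⟩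
  2 * suc a ^ 2 * a + a                            ≡⟨ cong (_∸ 1) (+-suc (2 * suc a ^ 2 * a) a) ⟨
  2 * suc a ^ 2 * a + suc a ∸ 1                    ∎
  where open ≤-Reasoning

module Degree {n m : ℕ} (G : Graph n) (Tr : Graph m) (f : Fin n → Fin m) (tree : IsTree Tr)
  (edge : ∀ u v → Adj G u v → f u ≡ f v ⊎ Adj Tr (f u) (f v))
  (k : ℕ) (2≤k : 2 ≤ k) (bag≤ : ∀ i → count (bag f i) ≤ k)
  (biconnected : BiconnectedRel G (SimPlus G k)) (v : Fin n) where

  open Decomposition G Tr f tree edge k (≤-trans (s≤s z≤n) 2≤k) bag≤ (f v)

  record ExitFrom (w : Fin n) : Set where
    field
      {a b} : Fin n
      w⇝a : Conn∖X w a
      a—b : Adj G a b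
      b∈X : f b ≡ f v
      v≁b : ¬ SimPlus G k v b

  -- Follows a walk of G/∼⁺ avoiding the class of v until it first enters the bag of f v.
  follow : ∀ {r w x y} → InBranch r (f w) → Conn∖X w x →
    Star (QStep G (SimPlus G k) (λ z → ¬ SimPlus G k v z)) x y → Conn∖X w y ⊎ ExitFrom w
  follow ib wx ε = inj₁ wx
  follow ib wx ((_ , _ , inj₁ xy) ◅ steps) = follow ib (Conn∖X-SimPlus ib wx xy) steps
  follow ib wx ((_ , v≁y , inj₂ (a , b , xa , yb , ab)) ◅ steps) with f b ≟ f v
  ... | yes fb≡t = inj₂ (record { w⇝a = Conn∖X-SimPlus ib wx xa ; a—b = ab ; b∈X = fb≡t
                                ; v≁b = λ vb → v≁y (vb ◅◅ SimPlus-sym G {k = k} yb) })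
  ... | no fb≢t =
    let wa = Conn∖X-SimPlus ib wx xa
        wb = wa ◅◅ (ab , InBranch-≢ (InBranch-Conn ib wa) , fb≢t) ◅ ε
    in follow ib (Conn∖X-SimPlus ib wb (SimPlus-sym G {k = k} yb)) steps

  Active : Fin m → Set
  Active s = s ≢ f v × ∃ λ w → Adj G v w × f w ≡ s

  abstract
    active? : ∀ s → Dec (Active s)
    active? s = ¬? (s ≟ f v) ×-dec any? (λ w → T? (Graph.adj G v w) ×-dec (f w ≟ s))

  active : Fin m → Bool
  active s = does (active? s)

  T-active⁺ : ∀ {s} → Active s → T (active s)
  T-active⁺ {s} act with active? s
  ... | yes _ = _
  ... | no ¬act = ¬act act

  T-active⁻ : ∀ {s} → T (active s) → Active s
  T-active⁻ {s} _ with active? s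
  ... | yes act = act

  neighbour-InBranch : ∀ {w} → Adj G v w → f w ≢ f v → InBranch (f w) (f w)
  neighbour-InBranch {w} vw fw≢t with edge v w vw
  ... | inj₁ fv≡fw = ⊥-elim (fw≢t (sym fv≡fw))
  ... | inj₂ t—fw = t—fw , ε

  record Exit (s : Fin m) : Set where
    field
      {w} : Fin n
      v—w : Adj G v w
      w∈branch : InBranch s (f w)
      out : ExitFrom w
    open ExitFrom out public


  Chain⇒path : ∀ {s} (e : Exit s) {qs} → Chain Adj∖X (Exit.w e) (Exit.a e) qs → Unique qs →
    IsPath G v (Exit.b e) qs × All (InBranch s ∘ f) qs
  Chain⇒path {s} e {qs} chain unique =
    (Chain⇒IsWalk-extend G proj₁ v—w chain a—b , v∉ ∷ Unique.++⁺ unique ([] ∷ []) b∉) , qs∈s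
    where
    open Exit e
    qs∈s : All (InBranch s ∘ f) qs
    qs∈s = Chain-All (InBranch s ∘ f) (λ ib xy → InBranch-Conn ib (xy ◅ ε)) w∈branch chain
    v∉ : All (v ≢_) (qs ++ [ b ])
    v∉ = All.++⁺ (All.map (λ ib v≡q → InBranch-≢ ib (cong f (sym v≡q))) qs∈s)
                 ((λ v≡b → v≁b (subst (SimPlus G k v) v≡b ε)) ∷ [])
    b∉ : ∀ {q} → ¬ (q ∈ qs × q ∈ [ b ])
    b∉ (q∈ , here refl) = InBranch-≢ (All.lookup qs∈s q∈) b∈X

  Exit⇒path : ∀ {s} (e : Exit s) →
    ∃ λ qs → (IsPath G v (Exit.b e) qs × All (InBranch s ∘ f) qs) × Exit.w e ∈ qs
  Exit⇒path e with qs , chain , unique , _ ← Chain-shorten _≟_ (proj₂ (Star⇒Chain (Exit.w⇝a e))) =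
    qs , Chain⇒path e chain unique , Chain-head chain

  exits⇒Sim : ∀ {b} (sel : Fin (2 * k) → Fin m) → Injective _≡_ _≡_ sel →
    (exits : ∀ i → Exit (sel i)) → (∀ i → Exit.b (exits i) ≡ b) → Sim G k v b
  exits⇒Sim {b} sel sel-inj exits targets = P , path , disjoint
    where
    P : Fin (2 * k) → List (Fin n)
    P i = proj₁ (Exit⇒path (exits i))
    path : ∀ i → IsPath G v b (P i)
    path i = subst (λ c → IsPath G v c (P i)) (targets i)
      (proj₁ (proj₁ (proj₂ (Exit⇒path (exits i)))))
    P∈branch : ∀ i → All (InBranch (sel i) ∘ f) (P i)
    P∈branch i = proj₂ (proj₁ (proj₂ (Exit⇒path (exits i))))
    w∈P : ∀ i → Exit.w (exits i) ∈ P i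
    w∈P i = proj₂ (proj₂ (Exit⇒path (exits i)))
    meet⇒≡ : ∀ {i j q} → q ∈ P i → q ∈ P j → i ≡ j
    meet⇒≡ {i} {j} q∈i q∈j =
      sel-inj (InBranch-unique (All.lookup (P∈branch i) q∈i) (All.lookup (P∈branch j) q∈j))
    disjoint : ∀ i j → i ≢ j → (P i ≢ P j) × (∀ q → q ∈ P i → q ∉ P j)
    disjoint i j i≢j = (λ Pi≡Pj → i≢j (meet⇒≡ (w∈P i) (subst (_ ∈_) Pi≡Pj (w∈P i)))) ,
                       (λ q q∈i q∈j → i≢j (meet⇒≡ q∈i q∈j))

  -- Biconnectivity of G/∼⁺ after deleting the class of v joins the branch of w to that of w′;
  -- the connecting walk has to pass through the bag of f v, which yields an exit.
  exit-between : ∀ {w w′} → Adj G v w → InBranch (f w) (f w) → InBranch (f w′) (f w′) →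
    f w′ ≢ f w → Exit (f w)
  exit-between {w} {w′} vw ib ib′ fw′≢fw
    with follow ib ε (proj₂ biconnected v w w′ (¬SimPlus-X→branch ib refl) (¬SimPlus-X→branch ib′ refl))
  ... | inj₁ ww′ = ⊥-elim (fw′≢fw (InBranch-unique ib′ (InBranch-Conn ib ww′)))
  ... | inj₂ out = record { v—w = vw ; w∈branch = ib ; out = out }

  TwoActive : Set
  TwoActive = ∃₂ λ s₁ s₂ → Active s₁ × Active s₂ × s₁ ≢ s₂

  neighbour-outside : TwoActive → ∀ s → ∃ λ w′ → Adj G v w′ × f w′ ≢ s × f w′ ≢ f v
  neighbour-outside (_ , _ , (s₁≢t , w₁ , vw₁ , refl) , (s₂≢t , w₂ , vw₂ , refl) , s₁≢s₂) s
    with s ≟ f w₁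
  ... | yes refl = w₂ , vw₂ , s₁≢s₂ ∘ sym , s₂≢t
  ... | no s≢s₁ = w₁ , vw₁ , s≢s₁ ∘ sym , s₁≢t

  index₀ : Fin (2 * k)
  index₀ = fromℕ< (≤-trans 2≤k (m≤m+n k _))

  module _ (two : TwoActive) where

    exit : ∀ s → Active s → Exit s
    exit s (s≢t , w , vw , refl) with w′ , vw′ , fw′≢s , fw′≢t ← neighbour-outside two s =
      exit-between vw (neighbour-InBranch vw s≢t) (neighbour-InBranch vw′ fw′≢t) fw′≢s

    target : Fin m → Fin n
    target s with active? s
    ... | yes act = Exit.b (exit s act)
    ... | no _ = v

    target-Exit : ∀ s → T (active s) → Σ (Exit s) λ e → Exit.b e ≡ target s
    target-Exit s _ with active? s
    ... | yes act = exit s act , refl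

    fibre≤ : ∀ b → count (λ s → active s ∧ does (target s ≟ b)) ≤ 2 * k ∸ 1
    fibre≤ b with 2 * k ≤? count (λ s → active s ∧ does (target s ≟ b))
    ... | no ≱2k = ∸-monoˡ-≤ 1 (≰⇒> ≱2k)
    ... | yes ≥2k with sel , sel-inj , in-fibre ← choose _ ≥2k =
      ⊥-elim (Exit.v≁b (exits index₀) v∼⁺b)
      where
      split : ∀ i → T (active (sel i)) × T (does (target (sel i) ≟ b))
      split i = to (T-∧ {active (sel i)}) (in-fibre i)
      exits : ∀ i → Exit (sel i)
      exits i = proj₁ (target-Exit (sel i) (proj₁ (split i)))
      targets : ∀ i → Exit.b (exits i) ≡ b
      targets i = trans (proj₂ (target-Exit (sel i) (proj₁ (split i)))) (T-≟⁻ (proj₂ (split i)))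
      v∼⁺b : SimPlus G k v (Exit.b (exits index₀))
      v∼⁺b = subst (SimPlus G k v) (sym (targets index₀)) (exits⇒Sim sel sel-inj exits targets ◅ ε)

  count-X∖v : ∀ (p : Fin n → Bool) → (∀ x → T (p x) → T (bag f (f v) x)) → ¬ T (p v) →
    count p ≤ k ∸ 1
  count-X∖v p p⊆X ¬pv =
    ∸-monoˡ-≤ 1 (≤-trans (count-mono-< p⊆X v ¬pv (T-≟⁺ {x = f v} refl)) (bag≤ (f v)))

  active-count-two : TwoActive → count active ≤ (2 * k ∸ 1) * (k ∸ 1)
  active-count-two two = ≤-trans (count-fibres (target two) target∈X∖v (λ b _ → fibre≤ two b))
    (*-monoʳ-≤ (2 * k ∸ 1) (count-X∖v X∖v (λ x → proj₁ ∘ to (T-∧ {bag f (f v) x})) v∉X∖v))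
    where
    X∖v : Fin n → Bool
    X∖v x = bag f (f v) x ∧ not (does (v ≟ x))
    v∉X∖v : ¬ T (X∖v v)
    v∉X∖v h = T-not-≟⁻ {x = v} (proj₂ (to (T-∧ {bag f (f v) v}) h)) refl
    target∈X∖v : ∀ s → T (active s) → T (X∖v (target two s))
    target∈X∖v s act = subst (T ∘ X∖v) b≡ (from T-∧
      (T-≟⁺ (Exit.b∈X e) , T-not-≟⁺ (λ v≡b → Exit.v≁b e (subst (SimPlus G k v) v≡b ε))))
      where
      e = proj₁ (target-Exit two s act)
      b≡ = proj₂ (target-Exit two s act)

  only-active : ¬ TwoActive → ∀ {s₁} → Active s₁ → ∀ s → T (active s) → T (does (s₁ ≟ s))
  only-active ¬two {s₁} act₁ s act with s₁ ≟ s
  ... | yes _ = _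
  ... | no s₁≢s = ¬two (s₁ , s , act₁ , T-active⁻ act , s₁≢s)

  active-count-one : ¬ TwoActive → count active ≤ 1
  active-count-one ¬two with any? active?
  ... | no none = ≤-trans (≤-reflexive (count-none active (λ s act → none (s , T-active⁻ act)))) z≤n
  ... | yes (s₁ , act₁) =
    ≤-trans (count-mono (only-active ¬two act₁)) (≤-reflexive (count-singleton s₁))

  active-count : count active ≤ (2 * k ∸ 1) * (k ∸ 1)
  active-count with any? (λ s₁ → any? (λ s₂ → active? s₁ ×-dec active? s₂ ×-dec ¬? (s₁ ≟ s₂)))
  ... | yes two = active-count-two two
  ... | no ¬two = ≤-trans (active-count-one ¬two) (1≤[2k∸1]*[k∸1] 2≤k)

  degree-count : count (Graph.adj G v) ≤ (k ∸ 1) + k * count active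
  degree-count = ≤-trans (count-split (Graph.adj G v) (bag f (f v))) (+-mono-≤ inside outside)
    where
    inside : count (λ w → Graph.adj G v w ∧ bag f (f v) w) ≤ k ∸ 1
    inside = count-X∖v _ (λ w → proj₂ ∘ to (T-∧ {Graph.adj G v w}))
      (λ h → Adj-irrefl G (proj₁ (to (T-∧ {Graph.adj G v v}) h)) refl)
    outside : count (λ w → Graph.adj G v w ∧ not (bag f (f v) w)) ≤ k * count active
    outside = count-fibres f
      (λ w h → let (vw , fw≢t) = to (T-∧ {Graph.adj G v w}) h in
        T-active⁺ (T-not-≟⁻ {x = f w} fw≢t , w , vw , refl))
      (λ s _ → ≤-trans (count-mono (λ w → proj₂ ∘ to (T-∧ {Graph.adj G v w ∧ not (bag f (f v) w)})))
                       (bag≤ s))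

  degree-bound : degree G v ≤ 2 * k ^ 2 * (k ∸ 1) + k ∸ 1
  degree-bound = begin
    degree G v                             ≡⟨ sum-allFin≡count (Graph.adj G v) ⟩
    count (Graph.adj G v)                  ≤⟨ degree-count ⟩
    (k ∸ 1) + k * count active             ≤⟨ +-monoʳ-≤ (k ∸ 1) (*-monoʳ-≤ k active-count) ⟩
    (k ∸ 1) + k * ((2 * k ∸ 1) * (k ∸ 1))  ≤⟨ degree-arith k ⟩
    2 * k ^ 2 * (k ∸ 1) + k ∸ 1            ∎
    where open ≤-Reasoning

lemma7 : ∀ (k : ℕ) → 2 ≤ k → ∀ {n} (G : Graph n) →
    stw≤ G k → BiconnectedRel G (SimPlus G k) →
    MaxDegree≤ G (2 * k ^ 2 * (k ∸ 1) + k ∸ 1)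
lemma7 k 2≤k G (_ , Tr , f , (tree , _ , edge) , bagSize≤) biconnected v =
  Degree.degree-bound G Tr f tree edge k 2≤k bag≤ biconnected v
  where
  bag≤ : ∀ i → count (bag f i) ≤ k
  bag≤ i = subst (_≤ k) (sum-allFin≡count (bag f i)) (bagSize≤ i)
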